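{- Let $G$ be a 4-connected planar triangulation with $n$ vertices and let $t$ be a positive integer. Then one of the following holds: (i) there exist two distinct vertices $v,x\in V(G)$ with $|N(v)\cap N(x)|>t$; (ii) there is an independent set $S$ of vertices of degree at most 6 in $G$ such that $S$ saturates no 4-cycle in $G$ and $|S|\ge n/(108t)$.
   Context: A planar triangulation is a plane graph in which every face is bounded by a 3-cycle. $N(v)$ denotes the neighbourhood of $v$. An independent set $S$ saturates a 4-cycle $C$ of $G$ if $|S\cap V(C)|=2$. -}

module Defs where

open import Data.Nat using (ℕ; zero; suc; _+_; _*_; _/_; _≤_; _<_; _>_)
open import Data.Bool using (Bool; true; false)
open import Data.Fin using (Fin)
open import Data.Fin.Subset using (Subset; ∣_∣; _∩_; _∪_; ⁅_⁆; _∈_; _∉_)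
open import Data.Vec using (tabulate; sum)
open import Data.Product using (Σ; ∃; _×_)
open import Relation.Binary.PropositionalEquality using (_≡_; _≢_)

record Graph (n : ℕ) : Set where
  field
    adj    : Fin n → Fin n → Bool
    sym    : ∀ u v → adj u v ≡ adj v u
    irrefl : ∀ v → adj v v ≡ false
open Graph public

module _ {n : ℕ} (G : Graph n) where

  N : Fin n → Subset n
  N v = tabulate (adj G v)

  deg : Fin n → ℕ
  deg v = ∣ N v ∣

  data Reach (X : Subset n) : Fin n → Fin n → Set where
    here : ∀ {u} → u ∉ X → Reach X u u
    step : ∀ {u v w} → u ∉ X → adj G u v ≡ true → Reach X v w → Reach X u w

  KConnected : ℕ → Set
  KConnected k = (k < n) × (∀ (X : Subset n) → ∣ X ∣ < k →
                   ∀ u v → u ∉ X → v ∉ X → Reach X u v)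

  Connected : Set
  Connected = ∀ u v → Reach Data.Fin.Subset.⊥ u v

  iter : ℕ → (Fin n → Fin n) → Fin n → Fin n
  iter zero    f x = x
  iter (suc k) f x = f (iter k f x)

  record RotationSystem : Set where
    field
      σ      : Fin n → Fin n → Fin n
      closed : ∀ v u → adj G v u ≡ true → adj G v (σ v u) ≡ true
      inj    : ∀ v u u' → adj G v u ≡ true → adj G v u' ≡ true →
               σ v u ≡ σ v u' → u ≡ u'
      cyclic : ∀ v u w → adj G v u ≡ true → adj G v w ≡ true →
               ∃ λ k → iter k (σ v) u ≡ w

  -- Face tracing: dart (u,v) is followed by dart (v, σ v u).
  -- Every face is a triangle: three steps from (u,v) return to (u,v).
  AllFacesTriangles : RotationSystem → Set
  AllFacesTriangles R = ∀ u v → adj G u v ≡ true →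
      let w = σ v u in (σ w v ≡ u) × (σ u w ≡ v)
    where open RotationSystem R

  -- number of darts = sum of degrees = 2|E|
  darts : ℕ
  darts = sum (tabulate deg)

  edges : ℕ
  edges = darts / 2

  -- when all faces are triangles, each face consists of exactly 3 darts
  facesOfTriangulated : ℕ
  facesOfTriangulated = darts / 3

  -- Planar triangulation: a connected simple graph with a rotation system all of whose
  -- faces are 3-cycles and whose Euler characteristic V - E + F equals 2 (sphere).
  PlanarTriangulation : Set
  PlanarTriangulation = Connected ×
    Σ RotationSystem (λ R → AllFacesTriangles R ×
                             (n + facesOfTriangulated ≡ edges + 2))

  Independent : Subset n → Set
  Independent S = ∀ u v → u ∈ S → v ∈ S → adj G u v ≡ false

  FourCycle : Fin n → Fin n → Fin n → Fin n → Set
  FourCycle a b c d =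
    (a ≢ b) × (a ≢ c) × (a ≢ d) × (b ≢ c) × (b ≢ d) × (c ≢ d) ×
    (adj G a b ≡ true) × (adj G b c ≡ true) × (adj G c d ≡ true) × (adj G d a ≡ true)

  Saturates : Subset n → Fin n → Fin n → Fin n → Fin n → Set
  Saturates S a b c d = ∣ S ∩ (⁅ a ⁆ ∪ (⁅ b ⁆ ∪ (⁅ c ⁆ ∪ ⁅ d ⁆))) ∣ ≡ 2

  SaturatesNoFourCycle : Subset n → Set
  SaturatesNoFourCycle S = ∀ a b c d → FourCycle a b c d → Saturates S a b c d → Data.Empty.⊥
    where import Data.Empty

module Submission where

-- Euler's formula bounds the degree sum by 6n and 4-connectivity gives minimum degree 4,
-- so at least n/3 vertices have degree at most 6. Call two vertices in conflict if they are
-- equal, adjacent, or opposite on a 4-cycle: a conflict-free set is independent and meets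
-- every 4-cycle at most once. If no two vertices share more than t neighbours, a vertex of
-- degree at most 6 conflicts with at most 1 + 6 + (6 choose 2) t = 7 + 15t vertices, so a
-- maximal conflict-free set S of such vertices, chosen greedily, has n/3 ≤ (7 + 15t)|S| ≤ 36t|S|.

open import Data.Bool using (Bool; true; false; if_then_else_)
open import Data.Empty using (⊥-elim)
open import Data.Fin using (Fin; _≟_)
import Data.Fin as Fin
import Data.Fin.Properties as FinP
open import Data.Fin.Subset using (Subset; ∣_∣; _∩_; _∪_; ⋃; ⁅_⁆; _∈_; _∉_; _⊆_; _⊂_; ⊤; ⊥; inside; outside)
open import Data.Fin.Subset.Properties
open import Data.List using (List; length; allFin)
import Data.List as List
open import Data.List.Membership.Propositional using () renaming (_∈_ to _∈ₗ_)
open import Data.List.Membership.Propositional.Properties using (∈-allFin; ∈-map⁺; ∈-map⁻)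
open import Data.List.Properties using (length-map)
import Data.List.Relation.Unary.Any as Any
open import Data.Nat using (ℕ; zero; suc; _+_; _*_; _/_; _≤_; _<_; _>_; _≤?_; _<?_; s≤s; z≤n)
open import Data.Nat.Combinatorics using (_C_; nC1≡n; nCk+nC[k+1]≡[n+1]C[k+1])
open import Data.Nat.DivMod using (m≡m%n+[m/n]*n; m/n*n≤m; m%n<n)
open import Data.Nat.Properties hiding (_≟_)
open import Data.Nat.Tactic.RingSolver using (solve-∀)
open import Data.Product using (Σ; ∃; ∃₂; _×_; _,_)
open import Data.Sum using (_⊎_; inj₁; inj₂)
import Data.Sum as Sum
open import Data.Vec using (_∷_; []; here; there; tabulate; sum)
open import Data.Vec.Properties using (lookup∘tabulate; []=⇒lookup; lookup⇒[]=)
open import Function using (_∘_)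
open import Level using (0ℓ)
open import Relation.Binary using (Rel; Reflexive; Symmetric) renaming (Decidable to Decidable₂)
open import Relation.Binary.PropositionalEquality using (_≡_; _≢_; refl; trans; cong; subst)
  renaming (sym to ≡-sym)
open import Relation.Nullary using (Dec; yes; no; ¬_; does)
open import Relation.Nullary.Decidable using (_×-dec_; _⊎-dec_; ¬?; dec-true)
open import Relation.Unary using (Pred; Decidable)

open import Defs

private
  variable
    m : ℕ

∣p∪q∣≤∣p∣+∣q∣ : (p q : Subset m) → ∣ p ∪ q ∣ ≤ ∣ p ∣ + ∣ q ∣
∣p∪q∣≤∣p∣+∣q∣ []            []            = z≤n
∣p∪q∣≤∣p∣+∣q∣ (inside ∷ p)  (inside ∷ q)  = s≤s (≤-trans (∣p∪q∣≤∣p∣+∣q∣ p q) (+-monoʳ-≤ ∣ p ∣ (n≤1+n ∣ q ∣)))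
∣p∪q∣≤∣p∣+∣q∣ (inside ∷ p)  (outside ∷ q) = s≤s (∣p∪q∣≤∣p∣+∣q∣ p q)
∣p∪q∣≤∣p∣+∣q∣ (outside ∷ p) (inside ∷ q)  = ≤-trans (s≤s (∣p∪q∣≤∣p∣+∣q∣ p q)) (≤-reflexive (≡-sym (+-suc ∣ p ∣ ∣ q ∣)))
∣p∪q∣≤∣p∣+∣q∣ (outside ∷ p) (outside ∷ q) = ∣p∪q∣≤∣p∣+∣q∣ p q

∈-tabulate⁺ : ∀ (f : Fin m → Bool) {x} → f x ≡ true → x ∈ tabulate f
∈-tabulate⁺ f {x} fx = lookup⇒[]= x (tabulate f) (trans (lookup∘tabulate f x) fx)

∈-tabulate⁻ : ∀ (f : Fin m → Bool) {x} → x ∈ tabulate f → f x ≡ true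
∈-tabulate⁻ f {x} x∈ = trans (≡-sym (lookup∘tabulate f x)) ([]=⇒lookup x∈)

∣p∣<m⇒∃∉ : (p : Subset m) → ∣ p ∣ < m → ∃ λ x → x ∉ p
∣p∣<m⇒∃∉ {m} p ∣p∣<m with FinP.all? (_∈? p)
... | yes all∈ = ⊥-elim (<⇒≱ ∣p∣<m (subst (_≤ ∣ p ∣) (∣⊤∣≡n m) (p⊆q⇒∣p∣≤∣q∣ {p = ⊤} (λ {x} _ → all∈ x))))
... | no ¬all∈ = FinP.¬∀⟶∃¬ m (_∈ p) (_∈? p) ¬all∈

subsingleton⇒∣p∣≤1 : (p : Subset m) → (∀ {x y} → x ∈ p → y ∈ p → x ≡ y) → ∣ p ∣ ≤ 1
subsingleton⇒∣p∣≤1 {m} p unique with nonempty? p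
... | yes (y , y∈p) = ≤-trans (p⊆q⇒∣p∣≤∣q∣ (λ x∈p → subst (_∈ ⁅ y ⁆) (≡-sym (unique x∈p y∈p)) (x∈⁅x⁆ y)))
                              (≤-reflexive (∣⁅x⁆∣≡1 y))
... | no empty rewrite Empty-unique empty | ∣⊥∣≡0 m = z≤n

pairwise-∩-dichotomy : (F : Fin m → Subset m) (t : ℕ) →
  (Σ (Fin m) λ v → Σ (Fin m) λ x → (v ≢ x) × (∣ F v ∩ F x ∣ > t))
  ⊎ (∀ u v → u ≢ v → ∣ F u ∩ F v ∣ ≤ t)
pairwise-∩-dichotomy F t with FinP.any? (λ v → FinP.any? λ x → ¬? (v ≟ x) ×-dec (t <? ∣ F v ∩ F x ∣))
... | yes large = inj₁ large
... | no ¬large = inj₂ λ u v u≢v → ≮⇒≥ λ t<∣Fu∩Fv∣ → ¬large (u , v , u≢v , t<∣Fu∩Fv∣)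

toList : Subset m → List (Fin m)
toList []            = List.[]
toList (inside ∷ p)  = Fin.zero List.∷ List.map Fin.suc (toList p)
toList (outside ∷ p) = List.map Fin.suc (toList p)

length-toList : (p : Subset m) → length (toList p) ≡ ∣ p ∣
length-toList []            = refl
length-toList (inside ∷ p)  = cong suc (trans (length-map Fin.suc (toList p)) (length-toList p))
length-toList (outside ∷ p) = trans (length-map Fin.suc (toList p)) (length-toList p)

∈-toList : (p : Subset m) {x : Fin m} → x ∈ p → x ∈ₗ toList p
∈-toList (inside ∷ p)  here        = Any.here refl
∈-toList (inside ∷ p)  (there x∈p) = Any.there (∈-map⁺ Fin.suc (∈-toList p x∈p))
∈-toList (outside ∷ p) (there x∈p) = ∈-map⁺ Fin.suc (∈-toList p x∈p)

m*a≤sum[f]+∣b∣*c : ∀ {a c} (f : Fin m → ℕ) (b : Fin m → Bool) →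
  (∀ i → a ≤ f i + (if b i then c else 0)) →
  m * a ≤ sum (tabulate f) + ∣ tabulate b ∣ * c
m*a≤sum[f]+∣b∣*c {zero}  f b bound = z≤n
m*a≤sum[f]+∣b∣*c {suc m} {c = c} f b bound
  with b Fin.zero | bound Fin.zero | m*a≤sum[f]+∣b∣*c (f ∘ Fin.suc) (b ∘ Fin.suc) (bound ∘ Fin.suc)
... | true  | bound₀ | ih = ≤-trans (+-mono-≤ bound₀ ih) (≤-reflexive (regroup (f Fin.zero) c _ ∣ tabulate (b ∘ Fin.suc) ∣))
  where
  regroup : ∀ x c s k → x + c + (s + k * c) ≡ x + s + (c + k * c)
  regroup = solve-∀
... | false | bound₀ | ih = ≤-trans (+-mono-≤ bound₀ ih) (≤-reflexive (regroup (f Fin.zero) _ ∣ tabulate (b ∘ Fin.suc) ∣ c))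
  where
  regroup : ∀ x s k c → x + 0 + (s + k * c) ≡ x + s + k * c
  regroup = solve-∀

-- D / 2 and D / 3 truncate; only 3 * (D / 3) ≤ D and D ≤ 2 * (D / 2) + 1 are used.
euler⇒D≤6n : ∀ D n → n + D / 3 ≡ D / 2 + 2 → D ≤ n * 6
euler⇒D≤6n D n euler = ≤-trans (m≤m+n D 9) (+-cancelʳ-≤ (f * 6) (D + 9) (n * 6) (begin
    D + 9 + f * 6       ≡⟨ regroup₁ D f ⟩
    D + 9 + f * 3 * 2   ≤⟨ +-monoʳ-≤ (D + 9) (*-monoˡ-≤ 2 (m/n*n≤m D 3)) ⟩
    D + 9 + D * 2       ≡⟨ regroup₂ D ⟩
    D * 3 + 9           ≤⟨ +-monoˡ-≤ 9 (*-monoˡ-≤ 3 D≤1+2h) ⟩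
    (1 + h * 2) * 3 + 9 ≡⟨ regroup₃ h ⟩
    (h + 2) * 6         ≡⟨ cong (_* 6) (≡-sym euler) ⟩
    (n + f) * 6         ≡⟨ *-distribʳ-+ 6 n f ⟩
    n * 6 + f * 6       ∎))
  where
  open ≤-Reasoning
  f h : ℕ
  f = D / 3
  h = D / 2
  D≤1+2h : D ≤ 1 + h * 2
  D≤1+2h = ≤-trans (≤-reflexive (m≡m%n+[m/n]*n D 2)) (+-monoˡ-≤ (h * 2) (≤-pred (m%n<n D 2)))
  regroup₁ : ∀ D f → D + 9 + f * 6 ≡ D + 9 + f * 3 * 2
  regroup₁ = solve-∀
  regroup₂ : ∀ D → D + 9 + D * 2 ≡ D * 3 + 9
  regroup₂ = solve-∀
  regroup₃ : ∀ h → (1 + h * 2) * 3 + 9 ≡ (h + 2) * 6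
  regroup₃ = solve-∀

[1+k]C2≡k+kC2 : ∀ k → suc k C 2 ≡ k + k C 2
[1+k]C2≡k+kC2 k = trans (≡-sym (nCk+nC[k+1]≡[n+1]C[k+1] k 1)) (cong (_+ k C 2) (nC1≡n k))

C2-mono : ∀ {j k} → j ≤ k → j C 2 ≤ k C 2
C2-mono {k = zero} z≤n = ≤-refl
C2-mono {j} {suc k} j≤1+k with m≤n⇒m<n∨m≡n j≤1+k
... | inj₂ refl         = ≤-refl
... | inj₁ (s≤s j≤k) = ≤-trans (C2-mono j≤k) (≤-trans (m≤n+m (k C 2) k) (≤-reflexive (≡-sym ([1+k]C2≡k+kC2 k))))

s*[7+15t]*3≤108*t*s : ∀ t s → 1 ≤ t → s * (7 + 15 * t) * 3 ≤ 108 * t * s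
s*[7+15t]*3≤108*t*s t s 1≤t = begin
  s * (7 + 15 * t) * 3  ≡⟨ regroup s t ⟩
  (21 + 45 * t) * s     ≤⟨ *-monoˡ-≤ s (+-monoˡ-≤ (45 * t) (*-monoʳ-≤ 21 1≤t)) ⟩
  (21 * t + 45 * t) * s ≡⟨ cong (_* s) (≡-sym (*-distribʳ-+ t 21 45)) ⟩
  66 * t * s            ≤⟨ *-monoˡ-≤ s (*-monoˡ-≤ t (m≤m+n 66 42)) ⟩
  108 * t * s           ∎
  where
  open ≤-Reasoning
  regroup : ∀ s t → s * (7 + 15 * t) * 3 ≡ (21 + 45 * t) * s
  regroup = solve-∀

∈-⋃⁺ : ∀ {ps : List (Subset m)} {p x} → p ∈ₗ ps → x ∈ p → x ∈ ⋃ ps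
∈-⋃⁺ {ps = p List.∷ ps} (Any.here refl) x∈p = x∈p∪q⁺ (inj₁ x∈p)
∈-⋃⁺ {ps = q List.∷ ps} (Any.there p∈ps) x∈p = x∈p∪q⁺ (inj₂ (∈-⋃⁺ p∈ps x∈p))

∣⋃∣≤length*t : ∀ (ps : List (Subset m)) {t} → (∀ {p} → p ∈ₗ ps → ∣ p ∣ ≤ t) → ∣ ⋃ ps ∣ ≤ length ps * t
∣⋃∣≤length*t {m} List.[] bounded = ≤-reflexive (∣⊥∣≡0 m)
∣⋃∣≤length*t (p List.∷ ps) bounded =
  ≤-trans (∣p∪q∣≤∣p∣+∣q∣ p (⋃ ps)) (+-mono-≤ (bounded (Any.here refl)) (∣⋃∣≤length*t ps (bounded ∘ Any.there)))

module PairwiseShared {n : ℕ} (F : Fin n → Subset n) (t : ℕ)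
                        (∣F∩F∣≤t : ∀ x y → x ≢ y → ∣ F x ∩ F y ∣ ≤ t) where

  shared : Fin n → Fin n → Subset n
  shared x y with x ≟ y
  ... | yes _ = ⊥
  ... | no  _ = F x ∩ F y

  ∣shared∣≤t : ∀ x y → ∣ shared x y ∣ ≤ t
  ∣shared∣≤t x y with x ≟ y
  ... | yes _   = subst (_≤ t) (≡-sym (∣⊥∣≡0 n)) z≤n
  ... | no  x≢y = ∣F∩F∣≤t x y x≢y

  ∈-shared : ∀ {x y w} → x ≢ y → w ∈ F x → w ∈ F y → w ∈ shared x y
  ∈-shared {x} {y} x≢y w∈Fx w∈Fy with x ≟ y
  ... | yes x≡y = ⊥-elim (x≢y x≡y)
  ... | no  _   = x∈p∩q⁺ (w∈Fx , w∈Fy)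

  sharedByPairs : List (Fin n) → Subset n
  sharedByPairs List.[]         = ⊥
  sharedByPairs (x List.∷ xs) = ⋃ (List.map (shared x) xs) ∪ sharedByPairs xs

  ∣sharedByPairs∣≤ : ∀ xs → ∣ sharedByPairs xs ∣ ≤ (length xs C 2) * t
  ∣sharedByPairs∣≤ List.[]         = ≤-reflexive (∣⊥∣≡0 n)
  ∣sharedByPairs∣≤ (x List.∷ xs) = begin
    ∣ ⋃ (List.map (shared x) xs) ∪ sharedByPairs xs ∣               ≤⟨ ∣p∪q∣≤∣p∣+∣q∣ (⋃ (List.map (shared x) xs)) (sharedByPairs xs) ⟩
    ∣ ⋃ (List.map (shared x) xs) ∣ + ∣ sharedByPairs xs ∣           ≤⟨ +-mono-≤ ∣⋃shared∣ (∣sharedByPairs∣≤ xs) ⟩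
    length (List.map (shared x) xs) * t + (length xs C 2) * t ≡⟨ cong (λ k → k * t + (length xs C 2) * t) (length-map (shared x) xs) ⟩
    length xs * t + (length xs C 2) * t                         ≡⟨ *-distribʳ-+ t (length xs) (length xs C 2) ⟨
    (length xs + length xs C 2) * t                           ≡⟨ cong (_* t) ([1+k]C2≡k+kC2 (length xs)) ⟨
    (suc (length xs) C 2) * t                                   ∎
    where
    open ≤-Reasoning
    ∣⋃shared∣ = ∣⋃∣≤length*t (List.map (shared x) xs) λ p∈ →
      let y , _ , p≡ = ∈-map⁻ (shared x) p∈ in subst (λ p → ∣ p ∣ ≤ t) (≡-sym p≡) (∣shared∣≤t x y)

  ∈-sharedByPairs : ∀ {xs x y w} → x ∈ₗ xs → y ∈ₗ xs → x ≢ y → w ∈ F x → w ∈ F y → w ∈ sharedByPairs xs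
  ∈-sharedByPairs (Any.here refl)  (Any.here refl)  x≢y _ _ = ⊥-elim (x≢y refl)
  ∈-sharedByPairs (Any.here refl)  (Any.there y∈xs) x≢y w∈Fx w∈Fy =
    x∈p∪q⁺ (inj₁ (∈-⋃⁺ (∈-map⁺ _ y∈xs) (∈-shared x≢y w∈Fx w∈Fy)))
  ∈-sharedByPairs (Any.there x∈xs) (Any.here refl)  x≢y w∈Fx w∈Fy =
    x∈p∪q⁺ (inj₁ (∈-⋃⁺ (∈-map⁺ _ x∈xs) (∈-shared (x≢y ∘ ≡-sym) w∈Fy w∈Fx)))
  ∈-sharedByPairs (Any.there x∈xs) (Any.there y∈xs) x≢y w∈Fx w∈Fy =
    x∈p∪q⁺ (inj₂ (∈-sharedByPairs x∈xs y∈xs x≢y w∈Fx w∈Fy))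

from-does : ∀ {A : Set} (a? : Dec A) → does a? ≡ true → A
from-does (yes a) _ = a

module _ {_≈_ : Rel (Fin m) 0ℓ} (_≈?_ : Decidable₂ _≈_) where

  ball : Fin m → Subset m
  ball s = tabulate (λ w → does (s ≈? w))

  ∈-ball⁺ : ∀ {s w} → s ≈ w → w ∈ ball s
  ∈-ball⁺ {s} {w} s≈w = ∈-tabulate⁺ (λ w → does (s ≈? w)) (dec-true (s ≈? w) s≈w)

  ∈-ball⁻ : ∀ {s w} → w ∈ ball s → s ≈ w
  ∈-ball⁻ {s} {w} w∈ = from-does (s ≈? w) (∈-tabulate⁻ (λ w → does (s ≈? w)) w∈)

∈-insert⁻ : ∀ {x y} (p : Subset m) → x ∈ ⁅ y ⁆ ∪ p → x ≡ y ⊎ x ∈ p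
∈-insert⁻ {y = y} p x∈ = Sum.map₁ (x∈⁅y⁆⇒x≡y y) (x∈p∪q⁻ ⁅ y ⁆ p x∈)

∩-swap : ∀ (p q : Subset m) {x} → x ∈ p ∩ q → x ∈ q ∩ p
∩-swap p q {x} = subst (x ∈_) (∩-comm p q)

Apart : Rel (Fin m) 0ℓ → Subset m → Set
Apart _≈_ S = ∀ {s s'} → s ∈ S → s' ∈ S → s ≈ s' → s ≡ s'

∣apart∩clique∣≤1 : ∀ {_≈_ : Rel (Fin m) 0ℓ} {S X} → Apart _≈_ S →
                  (∀ {x y} → x ∈ X → y ∈ X → x ≈ y) → ∣ S ∩ X ∣ ≤ 1
∣apart∩clique∣≤1 {S = S} {X} apart clique = subsingleton⇒∣p∣≤1 (S ∩ X) λ x∈ y∈ →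
  let x∈S , x∈X = x∈p∩q⁻ S X x∈ ; y∈S , y∈X = x∈p∩q⁻ S X y∈ in apart x∈S y∈S (clique x∈X y∈X)

module GreedyPacking {n : ℕ} {_≈_ : Rel (Fin n) 0ℓ} (_≈?_ : Decidable₂ _≈_)
                     (≈-refl : Reflexive _≈_) (≈-sym : Symmetric _≈_)
                     {P : Pred (Fin n) 0ℓ} (P? : Decidable P)
                     (B : ℕ) (∣ball∣≤B : ∀ {s} → P s → ∣ ball _≈?_ s ∣ ≤ B) where

  record Packing (vs : List (Fin n)) : Set where
    field
      centres covered : Subset n
      centres-P       : ∀ {s} → s ∈ centres → P s
      centres-apart   : Apart _≈_ centres
      balls-covered   : ∀ {s w} → s ∈ centres → s ≈ w → w ∈ covered
      covers          : ∀ {v} → v ∈ₗ vs → P v → v ∈ covered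
      ∣covered∣≤      : ∣ covered ∣ ≤ ∣ centres ∣ * B
  open Packing

  empty : Packing List.[]
  empty = record
    { centres = ⊥ ; covered = ⊥
    ; centres-P = ⊥-elim ∘ ∉⊥ ; centres-apart = λ s∈ → ⊥-elim (∉⊥ s∈)
    ; balls-covered = λ s∈ → ⊥-elim (∉⊥ s∈) ; covers = λ ()
    ; ∣covered∣≤ = ≤-reflexive (trans (∣⊥∣≡0 n) (≡-sym (cong (_* B) (∣⊥∣≡0 n)))) }

  same-centres : ∀ {v vs} (I : Packing vs) →
                 (∀ {w} → w ∈ₗ v List.∷ vs → P w → w ∈ covered I) → Packing (v List.∷ vs)
  same-centres I covers′ = record
    { centres = centres I ; covered = covered I
    ; centres-P = centres-P I ; centres-apart = centres-apart I ; balls-covered = balls-covered I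
    ; covers = covers′ ; ∣covered∣≤ = ∣covered∣≤ I }

  skip : ∀ {v vs} → ¬ P v → Packing vs → Packing (v List.∷ vs)
  skip ¬Pv I = same-centres I λ where
    (Any.here refl)  Pv → ⊥-elim (¬Pv Pv)
    (Any.there v∈vs) Pv → covers I v∈vs Pv

  near : ∀ {v vs s} (I : Packing vs) → s ∈ centres I → v ≈ s → Packing (v List.∷ vs)
  near I s∈ v≈s = same-centres I λ where
    (Any.here refl)  _  → balls-covered I s∈ (≈-sym v≈s)
    (Any.there v∈vs) Pv → covers I v∈vs Pv

  far : ∀ {v vs} (I : Packing vs) → P v → (∀ {s} → s ∈ centres I → ¬ v ≈ s) → Packing (v List.∷ vs)
  far {v} {vs} I Pv v≉centres = record
    { centres = ⁅ v ⁆ ∪ centres I ; covered = covered I ∪ ball _≈?_ v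
    ; centres-P = centres-P′ ; centres-apart = apart′ ; balls-covered = balls-covered′
    ; covers = covers′ ; ∣covered∣≤ = ∣covered∣≤′ }
    where
    centres-P′ : ∀ {s} → s ∈ ⁅ v ⁆ ∪ centres I → P s
    centres-P′ s∈ with ∈-insert⁻ (centres I) s∈
    ... | inj₁ refl = Pv
    ... | inj₂ s∈I  = centres-P I s∈I

    apart′ : Apart _≈_ (⁅ v ⁆ ∪ centres I)
    apart′ s∈ s′∈ s≈s′ with ∈-insert⁻ (centres I) s∈ | ∈-insert⁻ (centres I) s′∈
    ... | inj₁ refl | inj₁ refl = refl
    ... | inj₁ refl | inj₂ s′∈I = ⊥-elim (v≉centres s′∈I s≈s′)
    ... | inj₂ s∈I  | inj₁ refl = ⊥-elim (v≉centres s∈I (≈-sym s≈s′))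
    ... | inj₂ s∈I  | inj₂ s′∈I = centres-apart I s∈I s′∈I s≈s′

    balls-covered′ : ∀ {s w} → s ∈ ⁅ v ⁆ ∪ centres I → s ≈ w → w ∈ covered I ∪ ball _≈?_ v
    balls-covered′ s∈ s≈w with ∈-insert⁻ (centres I) s∈
    ... | inj₁ refl = x∈p∪q⁺ (inj₂ (∈-ball⁺ _≈?_ s≈w))
    ... | inj₂ s∈I  = x∈p∪q⁺ (inj₁ (balls-covered I s∈I s≈w))

    covers′ : ∀ {w} → w ∈ₗ v List.∷ vs → P w → w ∈ covered I ∪ ball _≈?_ v
    covers′ (Any.here refl)  _  = x∈p∪q⁺ (inj₂ (∈-ball⁺ _≈?_ ≈-refl))
    covers′ (Any.there w∈vs) Pw = x∈p∪q⁺ (inj₁ (covers I w∈vs Pw))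

    centres⊂ : centres I ⊂ ⁅ v ⁆ ∪ centres I
    centres⊂ = q⊆p∪q ⁅ v ⁆ (centres I) , v , x∈p∪q⁺ (inj₁ (x∈⁅x⁆ v)) , λ v∈I → v≉centres v∈I ≈-refl

    ∣covered∣≤′ : ∣ covered I ∪ ball _≈?_ v ∣ ≤ ∣ ⁅ v ⁆ ∪ centres I ∣ * B
    ∣covered∣≤′ = begin
      ∣ covered I ∪ ball _≈?_ v ∣            ≤⟨ ∣p∪q∣≤∣p∣+∣q∣ (covered I) (ball _≈?_ v) ⟩
      ∣ covered I ∣ + ∣ ball _≈?_ v ∣         ≤⟨ +-mono-≤ (∣covered∣≤ I) (∣ball∣≤B Pv) ⟩
      ∣ centres I ∣ * B + B                   ≡⟨ +-comm (∣ centres I ∣ * B) B ⟩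
      suc ∣ centres I ∣ * B                   ≤⟨ *-monoˡ-≤ B (p⊂q⇒∣p∣<∣q∣ centres⊂) ⟩
      ∣ ⁅ v ⁆ ∪ centres I ∣ * B               ∎
      where open ≤-Reasoning

  packing : ∀ vs → Packing vs
  packing List.[] = empty
  packing (v List.∷ vs) with packing vs | P? v
  ... | I | no ¬Pv = skip ¬Pv I
  ... | I | yes Pv with FinP.any? (λ s → (s ∈? centres I) ×-dec (v ≈? s))
  ...   | yes (s , s∈I , v≈s) = near I s∈I v≈s
  ...   | no v≉centres         = far I Pv (λ s∈I v≈s → v≉centres (_ , s∈I , v≈s))

  greedy-packing : Σ (Subset n) λ S → (∀ {s} → s ∈ S → P s) × Apart _≈_ S
                                      × ∣ tabulate (λ v → does (P? v)) ∣ ≤ ∣ S ∣ * B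
  greedy-packing = centres I , centres-P I , centres-apart I ,
    ≤-trans (p⊆q⇒∣p∣≤∣q∣ P⊆covered) (∣covered∣≤ I)
    where
    I : Packing (allFin n)
    I = packing (allFin n)
    P⊆covered : tabulate (λ v → does (P? v)) ⊆ covered I
    P⊆covered {v} v∈ = covers I (∈-allFin v) (from-does (P? v) (∈-tabulate⁻ (λ v → does (P? v)) v∈))

quadruple : Fin m → Fin m → Fin m → Fin m → Subset m
quadruple a b c d = ⁅ a ⁆ ∪ (⁅ b ⁆ ∪ (⁅ c ⁆ ∪ ⁅ d ⁆))

∈-quadruple-elim : ∀ {P : Pred (Fin m) 0ℓ} {a b c d x} → P a → P b → P c → P d → x ∈ quadruple a b c d → P x
∈-quadruple-elim {a = a} {b} {c} {d} Pa Pb Pc Pd x∈ with ∈-insert⁻ _ x∈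
... | inj₁ refl = Pa
... | inj₂ x∈bcd with ∈-insert⁻ _ x∈bcd
...   | inj₁ refl = Pb
...   | inj₂ x∈cd with ∈-insert⁻ _ x∈cd
...     | inj₁ refl = Pc
...     | inj₂ x∈d rewrite x∈⁅y⁆⇒x≡y d x∈d = Pd

module _ {n : ℕ} (G : Graph n) where

  ∈N : ∀ {u v} → adj G u v ≡ true → v ∈ N G u
  ∈N {u} = ∈-tabulate⁺ (adj G u)

  N-sym : ∀ {u v} → v ∈ N G u → u ∈ N G v
  N-sym {u} {v} v∈Nu = ∈N (trans (sym G v u) (∈-tabulate⁻ (adj G u) v∈Nu))

  u∉N[u] : ∀ u → u ∉ N G u
  u∉N[u] u u∈Nu with trans (≡-sym (∈-tabulate⁻ (adj G u) u∈Nu)) (irrefl G u)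
  ... | ()

  reach-source : ∀ {X u w} → Reach G X u w → u ∉ X
  reach-source (here u∉X)     = u∉X
  reach-source (step u∉X _ _) = u∉X

  ∣N[v]∣≤1+deg : ∀ v → ∣ ⁅ v ⁆ ∪ N G v ∣ ≤ suc (deg G v)
  ∣N[v]∣≤1+deg v = ≤-trans (∣p∪q∣≤∣p∣+∣q∣ ⁅ v ⁆ (N G v)) (≤-reflexive (cong (_+ deg G v) (∣⁅x⁆∣≡1 v)))

  N-separates : ∀ {v w} → w ∉ ⁅ v ⁆ ∪ N G v → ¬ Reach G (N G v) v w
  N-separates w∉N[v] (here _)             = w∉N[v] (x∈p∪q⁺ (inj₁ (x∈⁅x⁆ _)))
  N-separates w∉N[v] (step _ v~u u⇝w) = reach-source u⇝w (∈N v~u)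

  kConnected⇒k≤deg : ∀ {k} → KConnected G k → ∀ v → k ≤ deg G v
  kConnected⇒k≤deg {k} (k<n , connected) v = ≮⇒≥ deg≮k
    where
    deg≮k : ¬ deg G v < k
    deg≮k deg<k with ∣p∣<m⇒∃∉ (⁅ v ⁆ ∪ N G v) (≤-<-trans (≤-trans (∣N[v]∣≤1+deg v) deg<k) k<n)
    ... | w , w∉N[v] =
      N-separates w∉N[v] (connected (N G v) deg<k v w (u∉N[u] v) (w∉N[v] ∘ x∈p∪q⁺ ∘ inj₂))

  planar⇒darts≤6n : PlanarTriangulation G → darts G ≤ n * 6
  planar⇒darts≤6n (_ , _ , _ , euler) = euler⇒D≤6n (darts G) n euler

  Low : Subset n
  Low = tabulate (λ v → does (deg G v ≤? 6))

  n≤3∣Low∣ : (∀ v → 4 ≤ deg G v) → darts G ≤ n * 6 → n ≤ ∣ Low ∣ * 3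
  n≤3∣Low∣ 4≤deg darts≤6n = +-cancelˡ-≤ (n * 6) n (∣ Low ∣ * 3) (begin
    n * 6 + n             ≡⟨ trans (+-comm (n * 6) n) (≡-sym (*-suc n 6)) ⟩
    n * 7                 ≤⟨ m*a≤sum[f]+∣b∣*c (deg G) (λ v → does (deg G v ≤? 6)) (λ v → weight (deg G v) (4≤deg v)) ⟩
    darts G + ∣ Low ∣ * 3 ≤⟨ +-monoˡ-≤ (∣ Low ∣ * 3) darts≤6n ⟩
    n * 6 + ∣ Low ∣ * 3   ∎)
    where
    open ≤-Reasoning
    weight : ∀ d → 4 ≤ d → 7 ≤ d + (if does (d ≤? 6) then 3 else 0)
    weight 1 (s≤s ())
    weight 2 (s≤s (s≤s ()))
    weight 3 (s≤s (s≤s (s≤s ())))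
    weight 4 _ = ≤-refl
    weight 5 _ = m≤m+n 7 1
    weight 6 _ = m≤m+n 7 2
    weight (suc (suc (suc (suc (suc (suc (suc d))))))) _ = ≤-trans (m≤m+n 7 d) (≤-reflexive (≡-sym (+-identityʳ _)))

  -- The last disjunct says that s and w are opposite vertices of a 4-cycle.
  Conflict : Rel (Fin n) 0ℓ
  Conflict s w = s ≡ w ⊎ w ∈ N G s ⊎ ∃₂ λ u u' → u ≢ u' × u ∈ N G s ∩ N G w × u' ∈ N G s ∩ N G w

  conflict? : Decidable₂ Conflict
  conflict? s w = (s ≟ w) ⊎-dec (w ∈? N G s) ⊎-dec FinP.any? λ u → FinP.any? λ u' →
    ¬? (u ≟ u') ×-dec (u ∈? N G s ∩ N G w) ×-dec (u' ∈? N G s ∩ N G w)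

  conflict-refl : Reflexive Conflict
  conflict-refl = inj₁ refl

  conflict-sym : Symmetric Conflict
  conflict-sym (inj₁ s≡w)         = inj₁ (≡-sym s≡w)
  conflict-sym (inj₂ (inj₁ w∈Ns)) = inj₂ (inj₁ (N-sym w∈Ns))
  conflict-sym {s} {w} (inj₂ (inj₂ (u , u' , u≢u' , u∈ , u'∈))) =
    inj₂ (inj₂ (u , u' , u≢u' , ∩-swap (N G s) (N G w) u∈ , ∩-swap (N G s) (N G w) u'∈))

  apart⇒independent : ∀ {S} → Apart Conflict S → Independent G S
  apart⇒independent apart u v u∈S v∈S with adj G u v in uv
  ... | false = refl
  ... | true with apart u∈S v∈S (inj₂ (inj₁ (∈N uv)))
  ...   | refl with trans (≡-sym uv) (irrefl G u)
  ...     | ()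

  fourCycle⇒conflicts : ∀ {a b c d} → FourCycle G a b c d → ∀ {x y} →
                        x ∈ quadruple a b c d → y ∈ quadruple a b c d → Conflict x y
  fourCycle⇒conflicts {a} {b} {c} {d} (_ , a≢c , _ , _ , b≢d , _ , ab , bc , cd , da) x∈ y∈ =
    ∈-quadruple-elim {P = λ x → ∀ {y} → y ∈ quadruple a b c d → Conflict x y}
      (∈-quadruple-elim {P = Conflict a} conflict-refl a~b a~c (conflict-sym d~a))
      (∈-quadruple-elim {P = Conflict b} (conflict-sym a~b) conflict-refl b~c b~d)
      (∈-quadruple-elim {P = Conflict c} (conflict-sym a~c) (conflict-sym b~c) conflict-refl c~d)
      (∈-quadruple-elim {P = Conflict d} d~a (conflict-sym b~d) (conflict-sym c~d) conflict-refl)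
      x∈ y∈
    where
    a~b : Conflict a b
    a~b = inj₂ (inj₁ (∈N ab))
    b~c : Conflict b c
    b~c = inj₂ (inj₁ (∈N bc))
    c~d : Conflict c d
    c~d = inj₂ (inj₁ (∈N cd))
    d~a : Conflict d a
    d~a = inj₂ (inj₁ (∈N da))
    a~c : Conflict a c
    a~c = inj₂ (inj₂ (b , d , b≢d , x∈p∩q⁺ (∈N ab , N-sym (∈N bc)) , x∈p∩q⁺ (N-sym (∈N da) , ∈N cd)))
    b~d : Conflict b d
    b~d = inj₂ (inj₂ (a , c , a≢c , x∈p∩q⁺ (N-sym (∈N ab) , ∈N da) , x∈p∩q⁺ (∈N bc , N-sym (∈N cd))))

  apart⇒saturatesNoFourCycle : ∀ {S} → Apart Conflict S → SaturatesNoFourCycle G S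
  apart⇒saturatesNoFourCycle apart a b c d cycle saturated =
    1+n≰n (subst (_≤ 1) saturated (∣apart∩clique∣≤1 apart (fourCycle⇒conflicts cycle)))

  module _ (t : ℕ) (∣N∩N∣≤t : ∀ u v → u ≢ v → ∣ N G u ∩ N G v ∣ ≤ t) where
    open PairwiseShared (N G) t ∣N∩N∣≤t

    ball⊆ : ∀ s → ball conflict? s ⊆ ⁅ s ⁆ ∪ (N G s ∪ sharedByPairs (toList (N G s)))
    ball⊆ s {w} w∈ with ∈-ball⁻ conflict? {s} w∈
    ... | inj₁ refl         = x∈p∪q⁺ (inj₁ (x∈⁅x⁆ s))
    ... | inj₂ (inj₁ w∈Ns) = x∈p∪q⁺ (inj₂ (x∈p∪q⁺ (inj₁ w∈Ns)))
    ... | inj₂ (inj₂ (u , u' , u≢u' , u∈ , u'∈))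
      with x∈p∩q⁻ (N G s) (N G w) u∈ | x∈p∩q⁻ (N G s) (N G w) u'∈
    ...   | u∈Ns , u∈Nw | u'∈Ns , u'∈Nw = x∈p∪q⁺ (inj₂ (x∈p∪q⁺ (inj₂
            (∈-sharedByPairs (∈-toList _ u∈Ns) (∈-toList _ u'∈Ns) u≢u' (N-sym u∈Nw) (N-sym u'∈Nw)))))

    ∣ball∣≤ : ∀ {s d} → deg G s ≤ d → ∣ ball conflict? s ∣ ≤ 1 + d + (d C 2) * t
    ∣ball∣≤ {s} {d} deg≤d = begin
      ∣ ball conflict? s ∣                     ≤⟨ p⊆q⇒∣p∣≤∣q∣ (ball⊆ s) ⟩
      ∣ ⁅ s ⁆ ∪ (N G s ∪ opposite) ∣             ≤⟨ ∣p∪q∣≤∣p∣+∣q∣ ⁅ s ⁆ (N G s ∪ opposite) ⟩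
      ∣ ⁅ s ⁆ ∣ + ∣ N G s ∪ opposite ∣          ≤⟨ +-mono-≤ (≤-reflexive (∣⁅x⁆∣≡1 s)) (∣p∪q∣≤∣p∣+∣q∣ (N G s) opposite) ⟩
      1 + (deg G s + ∣ opposite ∣)              ≤⟨ +-monoʳ-≤ 1 (+-mono-≤ deg≤d ∣opposite∣≤) ⟩
      1 + d + (d C 2) * t                     ∎
      where
      open ≤-Reasoning
      opposite : Subset n
      opposite = sharedByPairs (toList (N G s))
      ∣opposite∣≤ : ∣ opposite ∣ ≤ (d C 2) * t
      ∣opposite∣≤ = ≤-trans (∣sharedByPairs∣≤ (toList (N G s)))
                    (*-monoˡ-≤ t (C2-mono (subst (_≤ d) (≡-sym (length-toList (N G s))) deg≤d)))

lemma2p5 : ∀ {n : ℕ} (G : Graph n) → PlanarTriangulation G → KConnected G 4 →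
    (t : ℕ) → t > 0 →
    (Σ (Fin n) λ v → Σ (Fin n) λ x → (v ≢ x) × (∣ N G v ∩ N G x ∣ > t))
    ⊎ (Σ (Subset n) λ S → Independent G S × (∀ v → v ∈ S → deg G v ≤ 6)
         × SaturatesNoFourCycle G S × (n ≤ 108 * t * ∣ S ∣))
lemma2p5 {n} G triangulation 4-connected t t>0 with pairwise-∩-dichotomy (N G) t
... | inj₁ large = inj₁ large
... | inj₂ small =
  let S , S-low , S-apart , ∣Low∣≤ = GreedyPacking.greedy-packing (conflict? G) (conflict-refl G) (conflict-sym G)
                                       (λ v → deg G v ≤? 6) (7 + 15 * t) (∣ball∣≤ G t small)
  in inj₂ (S , apart⇒independent G S-apart , (λ _ → S-low) , apart⇒saturatesNoFourCycle G S-apart , (begin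
    n                        ≤⟨ n≤3∣Low∣ G (kConnected⇒k≤deg G 4-connected) (planar⇒darts≤6n G triangulation) ⟩
    ∣ Low G ∣ * 3            ≤⟨ *-monoˡ-≤ 3 ∣Low∣≤ ⟩
    ∣ S ∣ * (7 + 15 * t) * 3 ≤⟨ s*[7+15t]*3≤108*t*s t ∣ S ∣ t>0 ⟩
    108 * t * ∣ S ∣          ∎))
  where open ≤-Reasoning
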